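{- Let $G$ be a tree-path intersection graph with the rooting and order $\le$ described in the context. If $\Gamma(s_1)\cap\Gamma(s_2)\neq\emptyset$ and $\min\Gamma(s_1)\le\min\Gamma(s_2)$, then $\min\Gamma(s_2)\in\Gamma(s_1)$.
   Context: A tree-path intersection graph is a connected bipartite graph $G$ with disjoint parts $G_H$, $G_V$, together with a tree $T_H$ on vertex set $G_H$ and a tree $T_V$ on vertex set $G_V$, such that for every $h\in G_H$ the neighbourhood $\Gamma(h)$ of $h$ in $G$ is the vertex set of a path in $T_V$, and for every $v\in G_V$ the neighbourhood $\Gamma(v)$ is the vertex set of a path in $T_H$. Fix an edge $h_{\mathrm{root}}v_{\mathrm{root}}\in E(G)$ such that $v_{\mathrm{root}}$ is a leaf of $T_V$; root $T_H$ at $h_{\mathrm{root}}$ and $T_V$ at $v_{\mathrm{root}}$. For $s_1,s_2$ both in $G_H$ (resp. both in $G_V$), $s_1\le s_2$ iff $s_1$ lies on the path of $T_H$ (resp. $T_V$) from the root to $s_2$; vertices from different sides are incomparable. $\min\Gamma(s)$ denotes the unique $\le$-minimal element of $\Gamma(s)$ (it exists since $\Gamma(s)$ is a path in a rooted tree). -}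

module Defs where

open import Data.Nat using (ℕ; _≤_)
open import Data.Fin using (Fin)
open import Data.List using (List; []; _∷_; length)
open import Data.List.Membership.Propositional using (_∈_)
open import Data.List.Relation.Unary.Unique.Propositional using (Unique)
open import Data.Product using (Σ; ∃; ∃-syntax; _×_; _,_)
open import Data.Sum using (_⊎_; inj₁; inj₂)
open import Data.Empty using (⊥)
open import Relation.Nullary using (¬_)
open import Relation.Binary.PropositionalEquality using (_≡_)

record SimpleGraph (A : Set) : Set₁ where
  field
    Adj    : A → A → Set
    sym    : ∀ {x y} → Adj x y → Adj y x
    irrefl : ∀ {x} → ¬ Adj x x

data WalkFromTo {A : Set} (R : A → A → Set) : A → A → List A → Set where
  here : ∀ {x} → WalkFromTo R x x (x ∷ [])
  step : ∀ {x y z P} → R x y → WalkFromTo R y z P → WalkFromTo R x z (x ∷ P)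

PathFromTo : {A : Set} → (A → A → Set) → A → A → List A → Set
PathFromTo R u v P = WalkFromTo R u v P × Unique P

Connected : {A : Set} → (A → A → Set) → Set
Connected {A} R = (u v : A) → ∃[ P ] PathFromTo R u v P

Acyclic : {A : Set} → (A → A → Set) → Set
Acyclic {A} R = (u v : A) (P : List A) → PathFromTo R u v P → 3 ≤ length P → ¬ R v u

IsTree : {A : Set} → SimpleGraph A → Set
IsTree T = Connected (SimpleGraph.Adj T) × Acyclic (SimpleGraph.Adj T)

IsPathVertexSet : {A : Set} → SimpleGraph A → (A → Set) → Set
IsPathVertexSet {A} T S =
  ∃[ u ] ∃[ v ] ∃[ P ] (PathFromTo (SimpleGraph.Adj T) u v P × ((x : A) → (S x → x ∈ P) × (x ∈ P → S x)))

Leaf : {A : Set} → SimpleGraph A → A → Set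
Leaf {A} T v = ∃[ x ] (SimpleGraph.Adj T v x × ((y : A) → SimpleGraph.Adj T v y → y ≡ x))

TreeLE : {A : Set} → SimpleGraph A → A → A → A → Set
TreeLE T r s₁ s₂ = ∃[ P ] (PathFromTo (SimpleGraph.Adj T) r s₂ P × s₁ ∈ P)

-- The bipartite graph G with parts G_H = Fin m, G_V = Fin n,
-- vertex set Fin m ⊎ Fin n.

BipAdj : {m n : ℕ} → (Fin m → Fin n → Set) → Fin m ⊎ Fin n → Fin m ⊎ Fin n → Set
BipAdj E (inj₁ h) (inj₂ v) = E h v
BipAdj E (inj₂ v) (inj₁ h) = E h v
BipAdj E (inj₁ _) (inj₁ _) = ⊥
BipAdj E (inj₂ _) (inj₂ _) = ⊥

record TreePathIntersectionGraph (m n : ℕ) : Set₁ where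
  field
    E         : Fin m → Fin n → Set
    TH        : SimpleGraph (Fin m)
    TV        : SimpleGraph (Fin n)
    TH-tree   : IsTree TH
    TV-tree   : IsTree TV
    connected : Connected (BipAdj E)
    Γh-path   : (h : Fin m) → IsPathVertexSet TV (λ v → E h v)
    Γv-path   : (v : Fin n) → IsPathVertexSet TH (λ h → E h v)

  Γ : Fin m ⊎ Fin n → Fin m ⊎ Fin n → Set
  Γ s x = BipAdj E s x

RootedLE : {m n : ℕ} → TreePathIntersectionGraph m n → Fin m → Fin n →
           Fin m ⊎ Fin n → Fin m ⊎ Fin n → Set
RootedLE G hr vr (inj₁ a) (inj₁ b) = TreeLE (TreePathIntersectionGraph.TH G) hr a b
RootedLE G hr vr (inj₂ a) (inj₂ b) = TreeLE (TreePathIntersectionGraph.TV G) vr a b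
RootedLE G hr vr (inj₁ _) (inj₂ _) = ⊥
RootedLE G hr vr (inj₂ _) (inj₁ _) = ⊥

IsMinimal : {A : Set} → (A → A → Set) → (A → Set) → A → Set
IsMinimal {A} _≼_ S a = S a × ((x : A) → S x → x ≼ a → x ≡ a)

{-# OPTIONS --safe #-}
-- Work in the tree on the side opposite to s₁ and s₂, where Γ(s₁) and Γ(s₂) are
-- paths meeting at some x. Since a ≤ b, the root path to b passes through a, so
-- its piece from a to b followed by the piece of Γ(s₂) from b to x is a walk from
-- a to x; it repeats no vertex, because a common vertex would be an element of
-- Γ(s₂) below b. Paths in a tree are unique, so this walk is the piece of Γ(s₁)
-- from a to x, and hence b ∈ Γ(s₁).
module Submission where

open import Defs
open import Data.Nat using (ℕ; _≤_; z≤n; s≤s)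
open import Data.Fin using (Fin)
open import Data.Fin.Properties using (_≟_)
open import Data.Sum using (_⊎_; inj₁; inj₂)
open import Data.Sum.Properties using (inj₁-injective; inj₂-injective)
open import Data.Product using (∃-syntax; _×_; _,_; proj₁; proj₂)
open import Data.List using (List; []; _∷_; _++_; drop; reverse; length)
open import Data.List.Properties using (unfold-reverse)
open import Data.List.Membership.Propositional using (_∈_; _∉_)
open import Data.List.Membership.Propositional.Properties using (∈-++⁻; ∈-++⁺ˡ)
open import Data.List.Relation.Unary.Any using (here; there)
open import Data.List.Relation.Unary.Any.Properties using (reverse⁻)
open import Data.List.Relation.Unary.All.Properties using (¬Any⇒All¬)
open import Data.List.Relation.Unary.Unique.Propositional using (Unique; []; _∷_)
open import Data.List.Relation.Unary.Unique.Propositional.Properties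
  using (++⁺; drop⁺; Unique[x∷xs]⇒x∉xs)
open import Data.List.Relation.Binary.Subset.Propositional using (_⊆_)
open import Data.List.Relation.Binary.Permutation.Setoid using (↭-sym)
open import Data.List.Relation.Binary.Permutation.Setoid.Properties using (Unique-resp-↭; ↭-reverse)
open import Data.Empty using (⊥; ⊥-elim)
open import Function.Definitions using (Injective)
open import Relation.Binary.Definitions using (DecidableEquality)
open import Relation.Binary.PropositionalEquality using (_≡_; _≢_; refl; sym; cong; subst; setoid)
open import Relation.Nullary using (yes; no)

module _ {A : Set} where

  Unique-∷ : ∀ {x : A} {xs} → x ∉ xs → Unique xs → Unique (x ∷ xs)
  Unique-∷ {xs = xs} x∉xs u = ¬Any⇒All¬ xs x∉xs ∷ u

  Unique-reverse : {xs : List A} → Unique xs → Unique (reverse xs)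
  Unique-reverse {xs} = Unique-resp-↭ (setoid A) (↭-sym (setoid A) (↭-reverse (setoid A) xs))

  drop-1⊆ : {xs : List A} → drop 1 xs ⊆ xs
  drop-1⊆ {_ ∷ _} = there

  ∈-++-drop-1⁻ : ∀ {z : A} xs {ys} → z ∈ xs ++ drop 1 ys → z ∈ xs ⊎ z ∈ ys
  ∈-++-drop-1⁻ xs z∈ with ∈-++⁻ xs z∈
  ... | inj₁ z∈xs = inj₁ z∈xs
  ... | inj₂ z∈ys = inj₂ (drop-1⊆ z∈ys)

module _ {A : Set} {R : A → A → Set} where

  WalkFromTo-head : ∀ {u v L} → WalkFromTo R u v L → L ≡ u ∷ drop 1 L
  WalkFromTo-head here = refl
  WalkFromTo-head (step _ _) = refl

  WalkFromTo-first∈ : ∀ {u v L} → WalkFromTo R u v L → u ∈ L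
  WalkFromTo-first∈ here = here refl
  WalkFromTo-first∈ (step _ _) = here refl

  WalkFromTo-last∈ : ∀ {u v L} → WalkFromTo R u v L → v ∈ L
  WalkFromTo-last∈ here = here refl
  WalkFromTo-last∈ (step _ w) = there (WalkFromTo-last∈ w)

  WalkFromTo-join : ∀ {u w v P Q} → WalkFromTo R u w P → WalkFromTo R w v Q →
                    WalkFromTo R u v (P ++ drop 1 Q)
  WalkFromTo-join here here = here
  WalkFromTo-join here (step r q) = step r q
  WalkFromTo-join (step r p) q = step r (WalkFromTo-join p q)

  WalkFromTo-2≤length : ∀ {u v L} → u ≢ v → WalkFromTo R u v L → 2 ≤ length L
  WalkFromTo-2≤length u≢u here = ⊥-elim (u≢u refl)
  WalkFromTo-2≤length _ (step _ here) = s≤s (s≤s z≤n)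
  WalkFromTo-2≤length _ (step _ (step _ _)) = s≤s (s≤s z≤n)

  PathFromTo-join : ∀ {u w v P Q} → PathFromTo R u w P → PathFromTo R w v Q →
                    (∀ {z} → z ∈ P → z ∈ Q → z ≡ w) → PathFromTo R u v (P ++ drop 1 Q)
  PathFromTo-join {w = w} {Q = Q} (p , uP) (q , uQ) meet =
    WalkFromTo-join p q , ++⁺ uP (drop⁺ 1 uQ) λ (z∈P , z∈Q′) →
      w∉Q′ (subst (_∈ drop 1 Q) (meet z∈P (drop-1⊆ z∈Q′)) z∈Q′)
    where
    w∉Q′ : w ∉ drop 1 Q
    w∉Q′ = Unique[x∷xs]⇒x∉xs (subst Unique (WalkFromTo-head q) uQ)

  PathFromTo-prefix : ∀ {u v y L} → PathFromTo R u v L → y ∈ L →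
                      ∃[ Q ] PathFromTo R u y Q × Q ⊆ L
  PathFromTo-prefix (here , _) (here refl) =
    _ , (here , Unique-∷ (λ ()) []) , λ { (here refl) → here refl }
  PathFromTo-prefix (step _ _ , _) (here refl) =
    _ , (here , Unique-∷ (λ ()) []) , λ { (here refl) → here refl }
  PathFromTo-prefix (step r p , uL@(_ ∷ uP)) (there y∈) with PathFromTo-prefix (p , uP) y∈
  ... | Q , (q , uQ) , Q⊆ =
    _ , (step r q , Unique-∷ (λ u∈Q → Unique[x∷xs]⇒x∉xs uL (Q⊆ u∈Q)) uQ) ,
    λ { (here refl) → here refl ; (there z∈Q) → there (Q⊆ z∈Q) }

module _ {A : Set} {R : A → A → Set} (R-sym : ∀ {x y} → R x y → R y x) where

  WalkFromTo-reverse : ∀ {u v L} → WalkFromTo R u v L → WalkFromTo R v u (reverse L)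
  WalkFromTo-reverse here = here
  WalkFromTo-reverse (step {x = x} {P = P} r p) =
    subst (WalkFromTo R _ x) (sym (unfold-reverse x P))
      (WalkFromTo-join (WalkFromTo-reverse p) (step (R-sym r) here))

  PathFromTo-reverse : ∀ {u v L} → PathFromTo R u v L → PathFromTo R v u (reverse L)
  PathFromTo-reverse (p , uL) = WalkFromTo-reverse p , Unique-reverse uL

  PathFromTo-segment : ∀ {u v x y L} → PathFromTo R u v L → x ∈ L → y ∈ L →
                       ∃[ Q ] PathFromTo R x y Q × Q ⊆ L
  PathFromTo-segment (here , uL) (here refl) y∈ = PathFromTo-prefix (here , uL) y∈
  PathFromTo-segment (step r p , uL) (here refl) y∈ = PathFromTo-prefix (step r p , uL) y∈
  PathFromTo-segment (step r p , uL) (there x∈) (here refl)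
    with PathFromTo-prefix (step r p , uL) (there x∈)
  ... | Q , q , Q⊆ = reverse Q , PathFromTo-reverse q , λ z∈ → Q⊆ (reverse⁻ z∈)
  PathFromTo-segment (step r p , _ ∷ uP) (there x∈) (there y∈)
    with PathFromTo-segment (p , uP) x∈ y∈
  ... | Q , q , Q⊆ = Q , q , λ z∈ → there (Q⊆ z∈)

module _ {A : Set} (_≟ᴬ_ : DecidableEquality A) {R : A → A → Set}
         (R-sym : ∀ {x y} → R x y → R y x) (acyclic : Acyclic R) where

  open import Data.List.Membership.DecPropositional _≟ᴬ_ using (_∈?_)

  PathFromTo-prefixToFirst∈ : ∀ {u v L} (ys : List A) → PathFromTo R u v L → v ∈ ys →
    ∃[ w ] ∃[ Q ] PathFromTo R u w Q × Q ⊆ L × w ∈ ys × (∀ {z} → z ∈ Q → z ∈ ys → z ≡ w)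
  PathFromTo-prefixToFirst∈ {u} ys p v∈ys with u ∈? ys
  ... | yes u∈ys =
    u , _ , (here , Unique-∷ (λ ()) []) , (λ { (here refl) → WalkFromTo-first∈ (proj₁ p) }) ,
    u∈ys , λ { (here refl) _ → refl }
  PathFromTo-prefixToFirst∈ ys (here , _) v∈ys | no v∉ys = ⊥-elim (v∉ys v∈ys)
  PathFromTo-prefixToFirst∈ ys (step r p , uL@(_ ∷ uP)) v∈ys | no u∉ys
    with PathFromTo-prefixToFirst∈ ys (p , uP) v∈ys
  ... | w , Q , (q , uQ) , Q⊆ , w∈ys , first =
    w , _ ∷ Q , (step r q , Unique-∷ (λ u∈Q → Unique[x∷xs]⇒x∉xs uL (Q⊆ u∈Q)) uQ) ,
    (λ { (here refl) → here refl ; (there z∈Q) → there (Q⊆ z∈Q) }) , w∈ys ,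
    λ { (here refl) u∈ys → ⊥-elim (u∉ys u∈ys) ; (there z∈Q) → first z∈Q }

  -- Following P from p′ up to its first vertex w on Q and then Q back to q′ closes
  -- a cycle through u.
  no-fork : ∀ {u p′ q′ v P Q} → R u p′ → R u q′ → p′ ≢ q′ →
            PathFromTo R p′ v P → PathFromTo R q′ v Q → u ∉ P → u ∉ Q → ⊥
  no-fork {u} {P = P} {Q} r r′ p′≢q′ p (q , uQ) u∉P u∉Q
    with PathFromTo-prefixToFirst∈ Q p (WalkFromTo-last∈ q)
  ... | w , Pw , pw , Pw⊆P , w∈Q , first
    with PathFromTo-prefix (q , uQ) w∈Q
  ... | Qw , qw , Qw⊆Q
    with PathFromTo-join pw (PathFromTo-reverse R-sym qw)
           (λ z∈Pw z∈Qw → first z∈Pw (Qw⊆Q (reverse⁻ z∈Qw)))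
  ... | c , uC =
    acyclic u _ _ (step r c , Unique-∷ u∉C uC) (s≤s (WalkFromTo-2≤length p′≢q′ c)) (R-sym r′)
    where
    u∉C : u ∉ Pw ++ drop 1 (reverse Qw)
    u∉C u∈C with ∈-++-drop-1⁻ Pw u∈C
    ... | inj₁ u∈Pw = u∉P (Pw⊆P u∈Pw)
    ... | inj₂ u∈Qw = u∉Q (Qw⊆Q (reverse⁻ u∈Qw))

  PathFromTo-unique : ∀ {u v P Q} → PathFromTo R u v P → PathFromTo R u v Q → P ≡ Q
  PathFromTo-unique (here , _) (here , _) = refl
  PathFromTo-unique (here , _) (step _ q , uQ) = ⊥-elim (Unique[x∷xs]⇒x∉xs uQ (WalkFromTo-last∈ q))
  PathFromTo-unique (step _ p , uP) (here , _) = ⊥-elim (Unique[x∷xs]⇒x∉xs uP (WalkFromTo-last∈ p))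
  PathFromTo-unique (step {y = p′} r p , uP@(_ ∷ uP′)) (step {y = q′} r′ q , uQ@(_ ∷ uQ′)) with p′ ≟ᴬ q′
  ... | yes refl = cong (_ ∷_) (PathFromTo-unique (p , uP′) (q , uQ′))
  ... | no p′≢q′ = ⊥-elim (no-fork r r′ p′≢q′ (p , uP′) (q , uQ′)
                             (Unique[x∷xs]⇒x∉xs uP) (Unique[x∷xs]⇒x∉xs uQ))

IsMinimal-∘ : ∀ {A B : Set} {f : A → B} {_≼_ : B → B → Set} {S : B → Set} {b : A} →
              Injective _≡_ _≡_ f → IsMinimal _≼_ S (f b) →
              IsMinimal (λ x y → f x ≼ f y) (λ x → S (f x)) b
IsMinimal-∘ f-injective (Sb , minimal) = Sb , λ x Sx x≼b → f-injective (minimal _ Sx x≼b)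

module _ {A : Set} (_≟ᴬ_ : DecidableEquality A) (T : SimpleGraph A)
         (acyclic : Acyclic (SimpleGraph.Adj T)) where

  open SimpleGraph T using () renaming (sym to Adj-sym)

  ancestor∈⇒minimum∈ : ∀ {r S₁ S₂ x a b} →
                       IsPathVertexSet T S₁ → IsPathVertexSet T S₂ → S₁ x → S₂ x → S₁ a →
                       IsMinimal (TreeLE T r) S₂ b → TreeLE T r a b → S₁ b
  ancestor∈⇒minimum∈ {x = x} {a} {b} (_ , _ , _ , p₁ , S₁⇔P₁) (_ , _ , _ , p₂ , S₂⇔P₂)
                     S₁x S₂x S₁a (S₂b , b-minimal) (Rb , rb , a∈Rb)
    with PathFromTo-segment Adj-sym p₁ (proj₁ (S₁⇔P₁ a) S₁a) (proj₁ (S₁⇔P₁ x) S₁x)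
       | PathFromTo-segment Adj-sym p₂ (proj₁ (S₂⇔P₂ b) S₂b) (proj₁ (S₂⇔P₂ x) S₂x)
       | PathFromTo-segment Adj-sym rb a∈Rb (WalkFromTo-last∈ (proj₁ rb))
  ... | Q₁ , q₁ , Q₁⊆P₁ | Q₂ , q₂ , Q₂⊆P₂ | Qab , qab , Qab⊆Rb =
    proj₂ (S₁⇔P₁ b) (Q₁⊆P₁ (subst (b ∈_) (sym Q₁≡Qab++Q₂) (∈-++⁺ˡ (WalkFromTo-last∈ (proj₁ qab)))))
    where
    Q₁≡Qab++Q₂ : Q₁ ≡ Qab ++ drop 1 Q₂
    Q₁≡Qab++Q₂ = PathFromTo-unique _≟ᴬ_ Adj-sym acyclic q₁
      (PathFromTo-join qab q₂ λ z∈Qab z∈Q₂ →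
        b-minimal _ (proj₂ (S₂⇔P₂ _) (Q₂⊆P₂ z∈Q₂)) (Rb , rb , Qab⊆Rb z∈Qab))

lemma10 : {m n : ℕ} (G : TreePathIntersectionGraph m n) (hr : Fin m) (vr : Fin n) →
          TreePathIntersectionGraph.E G hr vr →
          Leaf (TreePathIntersectionGraph.TV G) vr →
          (s₁ s₂ a b : Fin m ⊎ Fin n) →
          (∃[ x ] (TreePathIntersectionGraph.Γ G s₁ x × TreePathIntersectionGraph.Γ G s₂ x)) →
          IsMinimal (RootedLE G hr vr) (TreePathIntersectionGraph.Γ G s₁) a →
          IsMinimal (RootedLE G hr vr) (TreePathIntersectionGraph.Γ G s₂) b →
          RootedLE G hr vr a b →
          TreePathIntersectionGraph.Γ G s₁ b
lemma10 G hr vr _ _ (inj₁ h₁) (inj₁ h₂) (inj₂ _) (inj₂ _) (inj₂ _ , e₁ , e₂) (Γ₁a , _) b-min a≤b =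
  ancestor∈⇒minimum∈ _≟_ TV (proj₂ TV-tree) (Γh-path h₁) (Γh-path h₂) e₁ e₂ Γ₁a
    (IsMinimal-∘ {_≼_ = RootedLE G hr vr} inj₂-injective b-min) a≤b
  where open TreePathIntersectionGraph G
lemma10 G hr vr _ _ (inj₂ v₁) (inj₂ v₂) (inj₁ _) (inj₁ _) (inj₁ _ , e₁ , e₂) (Γ₁a , _) b-min a≤b =
  ancestor∈⇒minimum∈ _≟_ TH (proj₂ TH-tree) (Γv-path v₁) (Γv-path v₂) e₁ e₂ Γ₁a
    (IsMinimal-∘ {_≼_ = RootedLE G hr vr} inj₁-injective b-min) a≤b
  where open TreePathIntersectionGraph G
lemma10 _ _ _ _ _ (inj₁ _) _ _ _ (inj₁ _ , () , _) _ _ _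
lemma10 _ _ _ _ _ (inj₂ _) _ _ _ (inj₂ _ , () , _) _ _ _
lemma10 _ _ _ _ _ (inj₁ _) (inj₂ _) _ _ (inj₂ _ , _ , ()) _ _ _
lemma10 _ _ _ _ _ (inj₂ _) (inj₁ _) _ _ (inj₁ _ , _ , ()) _ _ _
lemma10 _ _ _ _ _ (inj₁ _) (inj₁ _) (inj₁ _) _ _ (() , _) _ _
lemma10 _ _ _ _ _ (inj₂ _) (inj₂ _) (inj₂ _) _ _ (() , _) _ _
lemma10 _ _ _ _ _ (inj₁ _) (inj₁ _) (inj₂ _) (inj₁ _) _ _ (() , _) _
lemma10 _ _ _ _ _ (inj₂ _) (inj₂ _) (inj₁ _) (inj₂ _) _ _ (() , _) _
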